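{- Let $F$ be a 2-CNF formula containing no semicomplete sub-multiset of clauses. Let $Q=G^0[U]$ be an induced star of $G^0$ with center $x$, and let $I=U\setminus\{x\}$. Then there is a set $X\subseteq U$ such that $w_X(Q)\ge|I|$.
   Context: A literal is a variable $x$ or its negation $\overline{x}$. A clause is a finite set of literals with no complementary pair; a 2-CNF formula is a finite multiset of clauses each with exactly 2 literals; clause $\{p,q\}$ is written $pq$. Two distinct clauses $Y,Z$ have a conflict if some $p\in Y$ has $\overline{p}\in Z$; a 2-CNF formula is semicomplete if it has exactly 4 clauses and every pair of distinct clauses has a conflict. For a literal $p$, $c(p)$ is the number of clauses containing $p$; $c(pq)$ the number of occurrences of clause $pq$. The auxiliary graph $G=(V,E)$ has $V=\mathrm{var}(F)$ and $xy\in E$ iff some clause $C$ has $\mathrm{var}(C)=\{x,y\}$; weights $w(x)=c(x)-c(\overline{x})$, $w(xy)=c(x\overline{y})+c(\overline{x}y)-c(xy)-c(\overline{x}\,\overline{y})$; $G^0$ is $G$ with all zero-weight edges removed, and $G^0[U]$ is the subgraph of $G^0$ induced by $U$. $G^0[U]$ is an induced star with center $x$ if $x$ is a vertex of $G^0$, $I$ is an independent set of $G^0$ consisting of neighbours of $x$ in $G^0$, and $U=\{x\}\cup I$. For $X\subseteq\mathrm{var}(F)$, $F_X$ is obtained from $F$ by replacing $x$ by $\overline{x}$ and $\overline{x}$ by $x$ for each $x\in X$, and $w_X$ denotes the weights computed in $F_X$; for a subgraph $Q=(U,H)$, $w_X(Q)=\sum_{y\in U}w_X(y)+\sum_{yz\in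 H}w_X(yz)$. -}

module Defs where

open import Data.Bool using (Bool; true; false; not; _∧_; _∨_; if_then_else_)
open import Data.Nat using (ℕ; _≡ᵇ_)
open import Data.Integer using (ℤ; +_; _-_; _+_; 0ℤ)
import Data.Integer.Properties as ℤP
open import Data.List using (List; []; _∷_; length; lookup; map)
open import Data.Bool.ListAction using (any)
open import Data.Integer using () renaming (_≟_ to _≟ℤ_)
open import Data.Nat using () renaming (_≟_ to _≟ℕ_)
open import Data.List.Relation.Unary.Any using (Any; any?)
open import Data.List.Relation.Unary.All using (All)
open import Data.List.Relation.Unary.Unique.Propositional using (Unique)
open import Data.List.Membership.Propositional using (_∈_)
open import Data.Fin using (Fin)
open import Data.Product using (Σ; _×_; _,_)
open import Data.Sum using (_⊎_)
open import Function.Definitions using (Injective)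
open import Relation.Binary.PropositionalEquality using (_≡_; _≢_)
open import Relation.Nullary using (¬_; Dec; does; ¬?)
open import Relation.Nullary.Decidable using (_×-dec_; _⊎-dec_)

record Literal : Set where
  constructor lit
  field
    var : ℕ
    pos : Bool
open Literal public

neg : Literal → Literal
neg (lit v b) = lit v (not b)

-- A clause with exactly two literals and no complementary pair:
-- two literals on distinct variables ({p,q} as an unordered pair).
record Clause : Set where
  constructor cl
  field
    fst : Literal
    snd : Literal
    distinct : var fst ≢ var snd
open Clause public

-- 2-CNF formula: finite multiset of clauses, as a list.
Formula : Set
Formula = List Clause

_∈C_ : Literal → Clause → Set
p ∈C C = p ≡ fst C ⊎ p ≡ snd C

Conflict : Clause → Clause → Set
Conflict Y Z = Σ Literal λ p → p ∈C Y × neg p ∈C Z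

-- F contains a semicomplete sub-multiset: 4 distinct occurrences
-- (positions) of clauses, every two of which have a conflict.
HasSemicomplete : Formula → Set
HasSemicomplete F =
  Σ (Fin 4 → Fin (length F)) λ f →
    Injective _≡_ _≡_ f ×
    (∀ i j → i ≢ j → Conflict (lookup F (f i)) (lookup F (f j)))

_==L_ : Literal → Literal → Bool
lit v b ==L lit u c = (v ≡ᵇ u) ∧ eqB b c
  where
  eqB : Bool → Bool → Bool
  eqB true true = true
  eqB false false = true
  eqB _ _ = false

count : (Clause → Bool) → Formula → ℕ
count P [] = 0
count P (C ∷ F) = if P C then Data.Nat.suc (count P F) else count P F

c : Formula → Literal → ℕ
c F p = count (λ C → (p ==L fst C) ∨ (p ==L snd C)) F

c2 : Formula → Literal → Literal → ℕ
c2 F p q = count (λ C → ((p ==L fst C) ∧ (q ==L snd C)) ∨ ((q ==L fst C) ∧ (p ==L snd C))) F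

wV : Formula → ℕ → ℤ
wV F x = + c F (lit x true) - + c F (lit x false)

wE : Formula → ℕ → ℕ → ℤ
wE F x y = + c2 F (lit x true) (lit y false) + + c2 F (lit x false) (lit y true)
           - + c2 F (lit x true) (lit y true) - + c2 F (lit x false) (lit y false)

InVar : Formula → ℕ → Set
InVar F x = Any (λ C → var (fst C) ≡ x ⊎ var (snd C) ≡ x) F

EdgeG : Formula → ℕ → ℕ → Set
EdgeG F x y = Any (λ C → (var (fst C) ≡ x × var (snd C) ≡ y) ⊎ (var (fst C) ≡ y × var (snd C) ≡ x)) F

EdgeG0 : Formula → ℕ → ℕ → Set
EdgeG0 F x y = EdgeG F x y × wE F x y ≢ 0ℤ

edgeG0? : (F : Formula) (x y : ℕ) → Dec (EdgeG0 F x y)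
edgeG0? F x y =
  any? (λ C → ((var (fst C) ≟ℕ x) ×-dec (var (snd C) ≟ℕ y)) ⊎-dec ((var (fst C) ≟ℕ y) ×-dec (var (snd C) ≟ℕ x))) F
  ×-dec ¬? (wE F x y ≟ℤ 0ℤ)

-- G^0[U] is an induced star with center x and leaf set I (U = x ∷ I)
InducedStar : Formula → ℕ → List ℕ → Set
InducedStar F x I =
  InVar F x × Unique I × All (EdgeG0 F x) I ×
  (∀ {y z} → y ∈ I → z ∈ I → ¬ EdgeG0 F y z)

flipLit : List ℕ → Literal → Literal
flipLit X (lit v b) = lit v (if any (v ≡ᵇ_) X then not b else b)

flipClause : List ℕ → Clause → Clause
flipClause X (cl p q d) = cl (flipLit X p) (flipLit X q) d

flipF : List ℕ → Formula → Formula
flipF X F = map (flipClause X) F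

sumℤ : List ℤ → ℤ
sumℤ [] = 0ℤ
sumℤ (a ∷ as) = a + sumℤ as

pairSum : (ℕ → ℕ → ℤ) → List ℕ → ℤ
pairSum f [] = 0ℤ
pairSum f (y ∷ ys) = sumℤ (map (f y) ys) + pairSum f ys

-- w_X(Q) for Q = G^0[U]: vertex weights over U plus edge weights over the
-- edges of G^0 inside U, all weights computed in F_X.
wXQ : Formula → List ℕ → List ℕ → ℤ
wXQ F X U =
  sumℤ (map (wV (flipF X F)) U) +
  pairSum (λ y z → if does (edgeG0? F y z) then wE (flipF X F) y z else 0ℤ) U

module Submission where

-- Flipping a set X of variables negates the vertex weight w(v)
-- exactly when v ∈ X, and the edge weight w(yz) exactly when one of y, z is
-- in X.  For an induced star Q with centre x and leaves I there are no edges
-- between leaves, so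
--   w_X(Q) = w_X(x) + Σ_{y∈I} (w_X(y) + w_X(xy)).
-- Fix whether x is flipped (a Boolean s); then leaf y contributes
-- ±(w(y) ± w(xy)), and flipping y exactly when w(y) ± w(xy) < 0 makes its
-- contribution |w(y) ± w(xy)|.  The two resulting choices X₀ (s = false) and
-- X₁ (s = true) satisfy
--   w_X₀(Q) + w_X₁(Q) = Σ_{y∈I} (|w(y) + w(xy)| + |w(y) − w(xy)|) ≥ 2|I|,
-- because w(xy) ≠ 0 for every edge of G⁰; hence one of them is ≥ |I|.

open import Defs
open import Data.Bool using (Bool; true; false; _∧_; _∨_; if_then_else_; _xor_)
open import Data.Bool.Properties using (∧-identityʳ; ∧-zeroʳ; ∨-zeroʳ; T?)
open import Data.Bool.ListAction using (any)
open import Data.Nat using (ℕ; zero; suc; _≡ᵇ_; _≟_)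
import Data.Nat as ℕ
import Data.Nat.Properties as ℕP
open import Data.Integer using (ℤ; +_; -[1+_]; -_; _-_; _+_; _*_; 0ℤ; ∣_∣; _≤_; _≥_; +≤+)
import Data.Integer.Properties as ℤP
open import Data.Integer.Tactic.RingSolver using (solve-∀)
open import Data.List using (List; []; _∷_; map; length; filterᵇ)
open import Data.List.Relation.Unary.All as All using (All)
open import Data.List.Relation.Unary.Any using (here; there)
open import Data.List.Membership.Propositional using (_∈_)
open import Data.List.Relation.Binary.Subset.Propositional.Properties using (filter-⊆)
open import Data.Product using (Σ; _×_; _,_; proj₁; proj₂)
open import Data.Sum using (_⊎_; inj₁; inj₂)
open import Function using (_∘_)
open import Relation.Binary.PropositionalEquality using (_≡_; _≢_; refl; sym; trans; cong; cong₂; module ≡-Reasoning)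
open import Relation.Nullary using (¬_; yes; no; does; contradiction)
open import Relation.Nullary.Decidable using (dec-true; dec-false)

≡ᵇ-refl : ∀ v → (v ≡ᵇ v) ≡ true
≡ᵇ-refl zero    = refl
≡ᵇ-refl (suc v) = ≡ᵇ-refl v

≢⇒≡ᵇ-false : ∀ {v u} → v ≢ u → (v ≡ᵇ u) ≡ false
≢⇒≡ᵇ-false {v} {u} v≢u with v ≡ᵇ u | ℕP.≡ᵇ⇒≡ v u
... | true  | sound = contradiction (sound _) v≢u
... | false | _     = refl

flips : List ℕ → ℕ → Bool
flips X v = any (v ≡ᵇ_) X

∈⇒flips : ∀ {v L} → v ∈ L → flips L v ≡ true
∈⇒flips {v} (here refl) rewrite ≡ᵇ-refl v = refl
∈⇒flips {v} {u ∷ L} (there v∈L) rewrite ∈⇒flips v∈L = ∨-zeroʳ (v ≡ᵇ u)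

flips-filterᵇ : ∀ f L v → flips (filterᵇ f L) v ≡ f v ∧ flips L v
flips-filterᵇ f [] v = sym (∧-zeroʳ (f v))
flips-filterᵇ f (u ∷ L) v with v ≟ u
... | no v≢u with f u
...   | true  rewrite ≢⇒≡ᵇ-false v≢u = flips-filterᵇ f L v
...   | false rewrite ≢⇒≡ᵇ-false v≢u = flips-filterᵇ f L v
flips-filterᵇ f (u ∷ L) v | yes refl with f v in fv
... | true  rewrite ≡ᵇ-refl v = refl
... | false = trans (flips-filterᵇ f L v) (cong (_∧ flips L v) fv)

count-map : ∀ (P : Clause → Bool) (h : Clause → Clause) F →
            count P (map h F) ≡ count (P ∘ h) F
count-map P h []      = refl
count-map P h (C ∷ F) = cong (λ n → if P (h C) then suc n else n) (count-map P h F)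

count-cong : ∀ {P Q : Clause → Bool} F → (∀ C → P C ≡ Q C) → count P F ≡ count Q F
count-cong []      P≗Q = refl
count-cong (C ∷ F) P≗Q =
  cong₂ (λ b n → if b then suc n else n) (P≗Q C) (count-cong F P≗Q)

==L-flipLit : ∀ X p q → (p ==L flipLit X q) ≡ (flipLit X p ==L q)
==L-flipLit X (lit v b) (lit u c) with v ≟ u
... | no v≢u rewrite ≢⇒≡ᵇ-false v≢u = refl
... | yes refl with flips X v | b | c
...   | false | _     | _     = refl
...   | true  | true  | true  = refl
...   | true  | true  | false = refl
...   | true  | false | true  = refl
...   | true  | false | false = refl

c-flip : ∀ X F p → c (flipF X F) p ≡ c F (flipLit X p)
c-flip X F p = trans (count-map _ (flipClause X) F) (count-cong F λ C →
  cong₂ _∨_ (==L-flipLit X p (fst C)) (==L-flipLit X p (snd C)))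

c2-flip : ∀ X F p q → c2 (flipF X F) p q ≡ c2 F (flipLit X p) (flipLit X q)
c2-flip X F p q = trans (count-map _ (flipClause X) F) (count-cong F λ C →
  cong₂ _∨_ (cong₂ _∧_ (==L-flipLit X p (fst C)) (==L-flipLit X q (snd C)))
            (cong₂ _∧_ (==L-flipLit X q (fst C)) (==L-flipLit X p (snd C))))

negateIf : Bool → ℤ → ℤ
negateIf true  i = - i
negateIf false i = i

wV-flip : ∀ X F v → wV (flipF X F) v ≡ negateIf (flips X v) (wV F v)
wV-flip X F v rewrite c-flip X F (lit v true) | c-flip X F (lit v false)
  with flips X v
... | false = refl
... | true  = swap-minus (+ c F (lit v false)) (+ c F (lit v true))
  where
  swap-minus : ∀ (a b : ℤ) → a - b ≡ - (b - a)
  swap-minus = solve-∀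

pairCount : Formula → ℕ → ℕ → Bool → Bool → ℤ
pairCount F y z a b = + c2 F (lit y a) (lit z b)

wE-flip : ∀ X F y z → wE (flipF X F) y z ≡ negateIf (flips X y xor flips X z) (wE F y z)
wE-flip X F y z
  rewrite c2-flip X F (lit y true) (lit z false) | c2-flip X F (lit y false) (lit z true)
        | c2-flip X F (lit y true) (lit z true)  | c2-flip X F (lit y false) (lit z false)
  with flips X y | flips X z
... | false | false = refl
... | true  | true  = both-flipped (n false true) (n true false) (n false false) (n true true)
  where
  n : Bool → Bool → ℤ
  n = pairCount F y z
  both-flipped : ∀ (a b d e : ℤ) → a + b - d - e ≡ b + a - e - d
  both-flipped = solve-∀
... | true  | false = y-flipped (n false false) (n true true) (n false true) (n true false)
  where
  n : Bool → Bool → ℤ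
  n = pairCount F y z
  y-flipped : ∀ (a b d e : ℤ) → a + b - d - e ≡ - (e + d - b - a)
  y-flipped = solve-∀
... | false | true  = z-flipped (n true true) (n false false) (n true false) (n false true)
  where
  n : Bool → Bool → ℤ
  n = pairCount F y z
  z-flipped : ∀ (a b d e : ℤ) → a + b - d - e ≡ - (d + e - a - b)
  z-flipped = solve-∀

sumℤ-+ : ∀ (f g : ℕ → ℤ) L →
         sumℤ (map f L) + sumℤ (map g L) ≡ sumℤ (map (λ y → f y + g y) L)
sumℤ-+ f g []      = refl
sumℤ-+ f g (y ∷ L) = begin
  (f y + sumℤ (map f L)) + (g y + sumℤ (map g L))
    ≡⟨ interchange (f y) (g y) (sumℤ (map f L)) (sumℤ (map g L)) ⟩
  (f y + g y) + (sumℤ (map f L) + sumℤ (map g L))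
    ≡⟨ cong (λ s → (f y + g y) + s) (sumℤ-+ f g L) ⟩
  (f y + g y) + sumℤ (map (λ y → f y + g y) L) ∎
  where
  open ≡-Reasoning
  interchange : ∀ a b c d → (a + c) + (b + d) ≡ (a + b) + (c + d)
  interchange = solve-∀

sumℤ-cong : ∀ {f g : ℕ → ℤ} L → (∀ {y} → y ∈ L → f y ≡ g y) →
            sumℤ (map f L) ≡ sumℤ (map g L)
sumℤ-cong []      f≗g = refl
sumℤ-cong (y ∷ L) f≗g = cong₂ _+_ (f≗g (here refl)) (sumℤ-cong L (f≗g ∘ there))

sumℤ-zero : ∀ (f : ℕ → ℤ) L → (∀ {y} → y ∈ L → f y ≡ 0ℤ) → sumℤ (map f L) ≡ 0ℤ
sumℤ-zero f []      f≗0 = refl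
sumℤ-zero f (y ∷ L) f≗0 = cong₂ _+_ (f≗0 (here refl)) (sumℤ-zero f L (f≗0 ∘ there))

pairSum-zero : ∀ f L → (∀ {y z} → y ∈ L → z ∈ L → f y z ≡ 0ℤ) → pairSum f L ≡ 0ℤ
pairSum-zero f []      f≗0 = refl
pairSum-zero f (y ∷ L) f≗0 = cong₂ _+_
  (sumℤ-zero (f y) L (f≗0 (here refl) ∘ there))
  (pairSum-zero f L λ y∈L z∈L → f≗0 (there y∈L) (there z∈L))

sumℤ-≥ : ∀ (k : ℤ) (f : ℕ → ℤ) L → (∀ {y} → y ∈ L → k ≤ f y) →
         + length L * k ≤ sumℤ (map f L)
sumℤ-≥ k f []      k≤f = ℤP.≤-reflexive (ℤP.*-zeroˡ k)
sumℤ-≥ k f (y ∷ L) k≤f = begin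
  + length (y ∷ L) * k          ≡⟨ ℤP.*-distribʳ-+ k (+ 1) (+ length L) ⟩
  + 1 * k + + length L * k      ≡⟨ cong (λ t → t + + length L * k) (ℤP.*-identityˡ k) ⟩
  k + + length L * k            ≤⟨ ℤP.+-mono-≤ (k≤f (here refl)) (sumℤ-≥ k f L (k≤f ∘ there)) ⟩
  f y + sumℤ (map f L)          ∎
  where open ℤP.≤-Reasoning

isNegative : ℤ → Bool
isNegative (+ _)    = false
isNegative -[1+ _ ] = true

negateIf-isNegative : ∀ i → negateIf (isNegative i) i ≡ + ∣ i ∣
negateIf-isNegative (+ n)    = refl
negateIf-isNegative -[1+ n ] = refl

negateIf-+ : ∀ s t b e → negateIf t b + negateIf (s xor t) e ≡ negateIf t (b + negateIf s e)
negateIf-+ false false b e = refl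
negateIf-+ true  false b e = refl
negateIf-+ false true  b e = sym (ℤP.neg-distrib-+ b e)
negateIf-+ true  true  b e = begin
  - b + e       ≡⟨ cong (λ t → - b + t) (sym (ℤP.neg-involutive e)) ⟩
  - b + - - e   ≡⟨ sym (ℤP.neg-distrib-+ b (- e)) ⟩
  - (b + - e)   ∎
  where open ≡-Reasoning

-- For a nonzero e, the two values b + e and b − e are at least 2 apart in
-- total absolute value: |b + e| + |b − e| ≥ |2e| ≥ 2.
∣+∣+∣-∣≥2 : ∀ b e → e ≢ 0ℤ → + 2 ≤ + ∣ b + e ∣ + + ∣ b - e ∣
∣+∣+∣-∣≥2 b e e≢0 = +≤+ (begin
  2                         ≤⟨ ∣e+e∣≥2 e e≢0 ⟩
  ∣ e + e ∣                 ≡⟨ cong ∣_∣ (difference b e) ⟩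
  ∣ (b + e) - (b - e) ∣     ≤⟨ ℤP.∣i-j∣≤∣i∣+∣j∣ (b + e) (b - e) ⟩
  ∣ b + e ∣ ℕ.+ ∣ b - e ∣   ∎)
  where
  open ℕP.≤-Reasoning
  ∣e+e∣≥2 : ∀ e → e ≢ 0ℤ → 2 ℕ.≤ ∣ e + e ∣
  ∣e+e∣≥2 (+ zero)    e≢0 = contradiction refl e≢0
  ∣e+e∣≥2 (+ suc n)   e≢0 = ℕP.+-mono-≤ (ℕ.s≤s ℕ.z≤n) (ℕ.s≤s ℕ.z≤n)
  ∣e+e∣≥2 -[1+ n ]    e≢0 = ℕ.s≤s (ℕ.s≤s ℕ.z≤n)
  difference : ∀ b e → e + e ≡ (b + e) - (b - e)
  difference = solve-∀

averaging : ∀ {a b m : ℤ} → m + m ≤ a + b → m ≤ a ⊎ m ≤ b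
averaging {a} {b} {m} 2m≤a+b with m ℤP.≤? a | m ℤP.≤? b
... | yes m≤a | _       = inj₁ m≤a
... | no _    | yes m≤b = inj₂ m≤b
... | no m≰a  | no m≰b  =
  contradiction 2m≤a+b (ℤP.<⇒≱ (ℤP.+-mono-< (ℤP.≰⇒> m≰a) (ℤP.≰⇒> m≰b)))

noLoop : ∀ F x → ¬ EdgeG F x x
noLoop (C ∷ F) x (here (inj₁ (p , q))) = distinct C (trans p (sym q))
noLoop (C ∷ F) x (here (inj₂ (p , q))) = distinct C (trans p (sym q))
noLoop (C ∷ F) x (there e)             = noLoop F x e

module StarFlip (F : Formula) (x : ℕ) (I : List ℕ)
                (spokes : All (EdgeG0 F x) I)
                (independent : ∀ {y z} → y ∈ I → z ∈ I → ¬ EdgeG0 F y z) where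

  edgeTerm : List ℕ → ℕ → ℕ → ℤ
  edgeTerm X y z = if does (edgeG0? F y z) then wE (flipF X F) y z else 0ℤ

  x≢leaf : ∀ {y} → y ∈ I → x ≢ y
  x≢leaf y∈I refl = noLoop F x (proj₁ (All.lookup spokes y∈I))

  star-decomposition : ∀ X → wXQ F X (x ∷ I) ≡
    wV (flipF X F) x + sumℤ (map (λ y → wV (flipF X F) y + wE (flipF X F) x y) I)
  star-decomposition X = begin
    (w x + sumℤ (map w I)) + (sumℤ (map (edgeTerm X x) I) + pairSum (edgeTerm X) I)
      ≡⟨ cong (λ t → (w x + sumℤ (map w I)) + (sumℤ (map (edgeTerm X x) I) + t))
              (pairSum-zero (edgeTerm X) I noLeafEdges) ⟩
    (w x + sumℤ (map w I)) + (sumℤ (map (edgeTerm X x) I) + 0ℤ)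
      ≡⟨ regroup (w x) (sumℤ (map w I)) (sumℤ (map (edgeTerm X x) I)) ⟩
    w x + (sumℤ (map w I) + sumℤ (map (edgeTerm X x) I))
      ≡⟨ cong (_+_ (w x)) (sumℤ-+ w (edgeTerm X x) I) ⟩
    w x + sumℤ (map (λ y → w y + edgeTerm X x y) I)
      ≡⟨ cong (_+_ (w x)) (sumℤ-cong I λ {y} y∈I → cong (_+_ (w y)) (spokeTerm y∈I)) ⟩
    w x + sumℤ (map (λ y → w y + wE (flipF X F) x y) I) ∎
    where
    open ≡-Reasoning
    w : ℕ → ℤ
    w = wV (flipF X F)
    noLeafEdges : ∀ {y z} → y ∈ I → z ∈ I → edgeTerm X y z ≡ 0ℤ
    noLeafEdges {y} {z} y∈I z∈I = cong (λ b → if b then wE (flipF X F) y z else 0ℤ)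
      (dec-false (edgeG0? F y z) (independent y∈I z∈I))
    spokeTerm : ∀ {y} → y ∈ I → edgeTerm X x y ≡ wE (flipF X F) x y
    spokeTerm {y} y∈I = cong (λ b → if b then wE (flipF X F) x y else 0ℤ)
      (dec-true (edgeG0? F x y) (All.lookup spokes y∈I))
    regroup : ∀ a b c → (a + b) + (c + 0ℤ) ≡ a + (b + c)
    regroup = solve-∀

  -- The value of leaf y before y itself is flipped, when x is flipped iff s.
  leafValue : Bool → ℕ → ℤ
  leafValue s y = wV F y + negateIf s (wE F x y)

  flipRule : Bool → ℕ → Bool
  flipRule s v = if v ≡ᵇ x then s else isNegative (leafValue s v)

  choice : Bool → List ℕ
  choice s = filterᵇ (flipRule s) (x ∷ I)

  choice-centre : ∀ s → flips (choice s) x ≡ s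
  choice-centre s = begin
    flips (choice s) x              ≡⟨ flips-filterᵇ (flipRule s) (x ∷ I) x ⟩
    flipRule s x ∧ flips (x ∷ I) x  ≡⟨ cong₂ (λ b c → (if b then s else isNegative (leafValue s x)) ∧ c)
                                             (≡ᵇ-refl x) (∈⇒flips {x} {x ∷ I} (here refl)) ⟩
    s ∧ true                        ≡⟨ ∧-identityʳ s ⟩
    s                               ∎
    where open ≡-Reasoning

  choice-leaf : ∀ s {y} → y ∈ I → flips (choice s) y ≡ isNegative (leafValue s y)
  choice-leaf s {y} y∈I = begin
    flips (choice s) y              ≡⟨ flips-filterᵇ (flipRule s) (x ∷ I) y ⟩
    flipRule s y ∧ flips (x ∷ I) y  ≡⟨ cong₂ (λ b c → (if b then s else isNegative (leafValue s y)) ∧ c)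
                                             (≢⇒≡ᵇ-false (x≢leaf y∈I ∘ sym))
                                             (∈⇒flips (there y∈I)) ⟩
    isNegative (leafValue s y) ∧ true ≡⟨ ∧-identityʳ _ ⟩
    isNegative (leafValue s y)        ∎
    where open ≡-Reasoning

  leaf-contribution : ∀ s {y} → y ∈ I →
    wV (flipF (choice s) F) y + wE (flipF (choice s) F) x y ≡ + ∣ leafValue s y ∣
  leaf-contribution s {y} y∈I = begin
    wV (flipF X F) y + wE (flipF X F) x y
      ≡⟨ cong₂ _+_ (wV-flip X F y) (wE-flip X F x y) ⟩
    negateIf (flips X y) (wV F y) + negateIf (flips X x xor flips X y) (wE F x y)
      ≡⟨ cong₂ (λ t u → negateIf t (wV F y) + negateIf (u xor t) (wE F x y))
               (choice-leaf s y∈I) (choice-centre s) ⟩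
    negateIf t (wV F y) + negateIf (s xor t) (wE F x y)
      ≡⟨ negateIf-+ s t (wV F y) (wE F x y) ⟩
    negateIf t (leafValue s y)
      ≡⟨ negateIf-isNegative (leafValue s y) ⟩
    + ∣ leafValue s y ∣ ∎
    where
    open ≡-Reasoning
    X : List ℕ
    X = choice s
    t : Bool
    t = isNegative (leafValue s y)

  choice-weight : ∀ s → wXQ F (choice s) (x ∷ I) ≡
    negateIf s (wV F x) + sumℤ (map (λ y → + ∣ leafValue s y ∣) I)
  choice-weight s = trans (star-decomposition (choice s)) (cong₂ _+_
    (trans (wV-flip (choice s) F x) (cong (λ b → negateIf b (wV F x)) (choice-centre s)))
    (sumℤ-cong I (leaf-contribution s)))

  -- The centre's weight cancels between the two choices, and each leaf
  -- contributes |w(y) + w(xy)| + |w(y) − w(xy)| ≥ 2.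
  choices-total : + length I + + length I ≤
                  wXQ F (choice false) (x ∷ I) + wXQ F (choice true) (x ∷ I)
  choices-total = begin
    n + n                                     ≡⟨ double n ⟩
    n * + 2                                   ≤⟨ sumℤ-≥ (+ 2) (λ y → a y + b y) I leafBound ⟩
    sumℤ (map (λ y → a y + b y) I)            ≡⟨ sumℤ-+ a b I ⟨
    sumℤ (map a I) + sumℤ (map b I)           ≡⟨ cancel (wV F x) (sumℤ (map a I)) (sumℤ (map b I)) ⟩
    (wV F x + sumℤ (map a I)) + (- wV F x + sumℤ (map b I))
      ≡⟨ cong₂ _+_ (choice-weight false) (choice-weight true) ⟨
    wXQ F (choice false) (x ∷ I) + wXQ F (choice true) (x ∷ I) ∎
    where
    open ℤP.≤-Reasoning
    n : ℤ
    n = + length I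
    a b : ℕ → ℤ
    a y = + ∣ leafValue false y ∣
    b y = + ∣ leafValue true y ∣
    leafBound : ∀ {y} → y ∈ I → + 2 ≤ a y + b y
    leafBound {y} y∈I = ∣+∣+∣-∣≥2 (wV F y) (wE F x y) (proj₂ (All.lookup spokes y∈I))
    double : ∀ m → m + m ≡ m * + 2
    double = solve-∀
    cancel : ∀ w p q → p + q ≡ (w + p) + (- w + q)
    cancel = solve-∀

  choice-⊆ : ∀ s → All (_∈ (x ∷ I)) (choice s)
  choice-⊆ s = All.tabulate (filter-⊆ (T? ∘ flipRule s) (x ∷ I))

  bestChoice : Σ (List ℕ) λ X → All (_∈ (x ∷ I)) X × wXQ F X (x ∷ I) ≥ + length I
  bestChoice with averaging choices-total
  ... | inj₁ reaches = choice false , choice-⊆ false , reaches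
  ... | inj₂ reaches = choice true  , choice-⊆ true  , reaches

lemma5p8 : (F : Formula) → ¬ HasSemicomplete F →
    (x : ℕ) (I : List ℕ) → InducedStar F x I →
    Σ (List ℕ) λ X → All (_∈ (x ∷ I)) X × wXQ F X (x ∷ I) ≥ + length I
lemma5p8 F _ x I (_ , _ , spokes , independent) =
  StarFlip.bestChoice F x I spokes independent
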